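{- Let $n,f\in\mathbb{N}$ with $f\ge 1$. Define $\tilde\rho_{f,n}$ on the generators of the type $B$ braid group $\mathcal{B}_n(B)$ by $$\tilde\rho_{f,n}(t)=\Delta_f^{ -2}\Delta_{f+1}^{2},\qquad \tilde\rho_{f,n}(\sigma_i)=\tilde\sigma_{f+i}\quad(1\le i\le n-1).$$ Then $\tilde\rho_{f,n}$ extends to a well-defined group homomorphism $\mathcal{B}_n(B)\to\mathcal{B}_{f+n}(A)$.
   Context: The braid group $\mathcal{B}_k(A)$ of type $A$ is the group with generators $\tilde\sigma_1,\dots,\tilde\sigma_{k-1}$ and relations $\tilde\sigma_i\tilde\sigma_j=\tilde\sigma_j\tilde\sigma_i$ for $|i-j|>1$ and $\tilde\sigma_i\tilde\sigma_{i+1}\tilde\sigma_i=\tilde\sigma_{i+1}\tilde\sigma_i\tilde\sigma_{i+1}$ for $1\le i\le k-2$. The braid group $\mathcal{B}_n(B)$ of type $B$ is the group with generators $t,\sigma_1,\dots,\sigma_{n-1}$ subject to: $\sigma_i\sigma_j=\sigma_j\sigma_i$ for $|i-j|>1$; $\sigma_i\sigma_{i+1}\sigma_i=\sigma_{i+1}\sigma_i\sigma_{i+1}$ for $1\le i\le n-2$; $\sigma_1t\sigma_1t=t\sigma_1t\sigma_1$; and $t\sigma_i=\sigma_it$ for $i>1$. For $k\ge1$ the full twist is $\Delta_k^2=(\tilde\sigma_{k-1}\cdots\tilde\sigma_1)^k\in\mathcal{B}_k(A)$ (with $\Delta_1^2=1$), regarded in $\mathcal{B}_{f+n}(A)$ via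 the natural inclusion on the first $k$ strands. -}

module Defs where

open import Data.Nat using (ℕ; zero; suc; _+_; _∸_; _≤_; _<_; s≤s; z≤n)
open import Data.Nat.Properties using (∸-monoˡ-≤; +-∸-assoc; +-monoʳ-<; +-monoʳ-≤; ≤-refl)
open import Data.Fin using (Fin; toℕ; fromℕ<; inject≤)
open import Data.Fin.Properties using (toℕ<n)
open import Data.List using (List; []; _∷_; _++_; reverse; map; concatMap; allFin; concat; replicate)
open import Relation.Binary.PropositionalEquality using (_≡_; subst; sym)

data Letter (G : Set) : Set where
  pos : G → Letter G
  neg : G → Letter G

Word : Set → Set
Word G = List (Letter G)

invLetter : {G : Set} → Letter G → Letter G
invLetter (pos g) = neg g
invLetter (neg g) = pos g

invWord : {G : Set} → Word G → Word G
invWord w = reverse (map invLetter w)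

-- The congruence on words generated by free cancellation and the
-- defining relations R.  Word G / (≈⟨ R ⟩) is the group ⟨ G | R ⟩.
data _≈⟨_⟩_ {G : Set} : Word G → (Word G → Word G → Set) → Word G → Set₁ where
  rel    : ∀ {R u v} → R u v → u ≈⟨ R ⟩ v
  cancel : ∀ {R} (x : Letter G) → (x ∷ invLetter x ∷ []) ≈⟨ R ⟩ []
  ≈refl  : ∀ {R u} → u ≈⟨ R ⟩ u
  ≈sym   : ∀ {R u v} → u ≈⟨ R ⟩ v → v ≈⟨ R ⟩ u
  ≈trans : ∀ {R u v w} → u ≈⟨ R ⟩ v → v ≈⟨ R ⟩ w → u ≈⟨ R ⟩ w
  ≈cong  : ∀ {R u v} (p q : Word G) → u ≈⟨ R ⟩ v → (p ++ u ++ q) ≈⟨ R ⟩ (p ++ v ++ q)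

extend : {G H : Set} → (G → Word H) → Word G → Word H
extend φ = concatMap λ { (pos g) → φ g ; (neg g) → invWord (φ g) }

-- Braid group of type A on k strands: generators σ̃_1 … σ̃_{k-1};
-- the element i : Fin (k ∸ 1) stands for σ̃_{toℕ i + 1}.

GenA : ℕ → Set
GenA k = Fin (k ∸ 1)

data RelA (k : ℕ) : Word (GenA k) → Word (GenA k) → Set where
  -- σ̃_i σ̃_j = σ̃_j σ̃_i for |i - j| > 1 (the case j > i+1; the other is by symmetry)
  commA  : (i j : GenA k) → suc (toℕ i) < toℕ j →
           RelA k (pos i ∷ pos j ∷ []) (pos j ∷ pos i ∷ [])
  braidA : (i j : GenA k) → toℕ j ≡ suc (toℕ i) →
           RelA k (pos i ∷ pos j ∷ pos i ∷ []) (pos j ∷ pos i ∷ pos j ∷ [])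

-- Braid group of type B: generators t, σ_1 … σ_{n-1};
-- σ i with i : Fin (n ∸ 1) stands for σ_{toℕ i + 1}.

data GenB (n : ℕ) : Set where
  t : GenB n
  σ : Fin (n ∸ 1) → GenB n

data RelB (n : ℕ) : Word (GenB n) → Word (GenB n) → Set where
  commB  : (i j : Fin (n ∸ 1)) → suc (toℕ i) < toℕ j →
           RelB n (pos (σ i) ∷ pos (σ j) ∷ []) (pos (σ j) ∷ pos (σ i) ∷ [])
  braidB : (i j : Fin (n ∸ 1)) → toℕ j ≡ suc (toℕ i) →
           RelB n (pos (σ i) ∷ pos (σ j) ∷ pos (σ i) ∷ [])
                  (pos (σ j) ∷ pos (σ i) ∷ pos (σ j) ∷ [])
  tσ₁    : (i : Fin (n ∸ 1)) → toℕ i ≡ 0 →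
           RelB n (pos (σ i) ∷ pos t ∷ pos (σ i) ∷ pos t ∷ [])
                  (pos t ∷ pos (σ i) ∷ pos t ∷ pos (σ i) ∷ [])
  tσᵢ    : (i : Fin (n ∸ 1)) → 1 ≤ toℕ i →
           RelB n (pos t ∷ pos (σ i) ∷ []) (pos (σ i) ∷ pos t ∷ [])

-- Full twist Δ_k² = (σ̃_{k-1} ⋯ σ̃_1)^k ∈ B_k(A)  (Δ_1² = 1, Δ_0² = 1)

fullTwist : (k : ℕ) → Word (GenA k)
fullTwist k = concat (replicate k (map pos (reverse (allFin (k ∸ 1)))))

inclA : {k N : ℕ} → k ≤ N → Word (GenA k) → Word (GenA N)
inclA {k} {N} k≤N = extend λ i → pos (inject≤ i (∸-monoˡ-≤ 1 k≤N)) ∷ []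

-- The assignment ρ̃_{f,n} on generators (n ≥ 1 so that Δ_{f+1}² ∈ B_{f+n}(A)).

private
  shiftLemma : (f n j : ℕ) → 1 ≤ n → j < n ∸ 1 → f + j < f + n ∸ 1
  shiftLemma f n j 1≤n j<n-1 =
    subst (f + j <_) (sym (+-∸-assoc f 1≤n)) (+-monoʳ-< f j<n-1)

  f≤f+n : (f n : ℕ) → f ≤ f + n
  f≤f+n zero n = z≤n
  f≤f+n (suc f) n = s≤s (f≤f+n f n)

  f+1≤f+n : (f n : ℕ) → 1 ≤ n → suc f ≤ f + n
  f+1≤f+n zero n 1≤n = 1≤n
  f+1≤f+n (suc f) n 1≤n = s≤s (f+1≤f+n f n 1≤n)

ρgen : (f n : ℕ) → 1 ≤ n → GenB n → Word (GenA (f + n))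
ρgen f n 1≤n t =
  invWord (inclA (f≤f+n f n) (fullTwist f)) ++ inclA (f+1≤f+n f n 1≤n) (fullTwist (suc f))
ρgen f n 1≤n (σ i) =
  pos (fromℕ< (shiftLemma f n (toℕ i) 1≤n (toℕ<n i))) ∷ []

ρ : (f n : ℕ) → 1 ≤ n → Word (GenB n) → Word (GenA (f + n))
ρ f n 1≤n = extend (ρgen f n 1≤n)

-- Write L_f = σ̃_f ⋯ σ̃_1 σ̃_1 ⋯ σ̃_f.  The full twists satisfy Δ_{f+1}² = Δ_f² L_f, so
-- ρ̃(t) = L_f.  The relation σ_1 t σ_1 t = t σ_1 t σ_1 then becomes
-- σ̃_{f+1} L_f σ̃_{f+1} L_f = L_f σ̃_{f+1} L_f σ̃_{f+1}, which follows by induction on f from the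
-- braid relations, and t σ_i = σ_i t (i > 1) holds because L_f only involves σ̃_1, …, σ̃_f, which
-- commute with σ̃_{f+i}.  The relations among the σ_i are those of B_{f+n}(A) shifted by f.

module Submission where

open import Defs
open import Data.Nat using (ℕ; zero; suc; _+_; _∸_; _≤_; _<_; s≤s; s≤s⁻¹; _<?_)
open import Data.Nat.Properties
open import Data.Nat.GeneralisedArithmetic using (fold)
open import Data.Fin using (Fin; toℕ; fromℕ<; inject≤)
open import Data.Fin.Properties using (toℕ<n; toℕ-fromℕ<; fromℕ<-toℕ; toℕ-inject≤)
open import Data.List using (List; []; _∷_; _++_; reverse; map; concat; concatMap; replicate; allFin; tabulate; applyUpTo; applyDownFrom)
open import Data.List.Properties using (++-assoc; ++-identityʳ; unfold-reverse; concatMap-++; concatMap-map; concatMap-cong; reverse-map; map-tabulate; reverse-applyUpTo)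
open import Data.Sum using (inj₁; inj₂)
open import Data.Empty using (⊥-elim)
open import Relation.Nullary using (yes; no)
open import Relation.Binary.PropositionalEquality
open import Function using (_∘_)

module Presentation {G : Set} (R : Word G → Word G → Set) where

  infix 4 _≈_
  _≈_ : Word G → Word G → Set₁
  u ≈ v = u ≈⟨ R ⟩ v

  open import Relation.Binary.Reasoning.Base.Single _≈_ ≈refl ≈trans public

  ≈-congˡ : ∀ p {u v} → u ≈ v → p ++ u ≈ p ++ v
  ≈-congˡ p {u} {v} u≈v =
    subst₂ _≈_ (cong (p ++_) (++-identityʳ u)) (cong (p ++_) (++-identityʳ v)) (≈cong p [] u≈v)

  ≈-congʳ : ∀ q {u v} → u ≈ v → u ++ q ≈ v ++ q
  ≈-congʳ q = ≈cong [] q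

  cancel-∷ : ∀ a X → a ∷ invLetter a ∷ X ≈ X
  cancel-∷ a X = ≈-congʳ X (cancel a)

  cancel-inv-∷ : ∀ a X → invLetter a ∷ a ∷ X ≈ X
  cancel-inv-∷ (pos g) X = cancel-∷ (neg g) X
  cancel-inv-∷ (neg g) X = cancel-∷ (pos g) X

  invWord-∷ : ∀ (a : Letter G) w → invWord (a ∷ w) ≡ invWord w ++ invLetter a ∷ []
  invWord-∷ a w = unfold-reverse (invLetter a) (map invLetter w)

  invWord-inverseʳ : ∀ w X → w ++ invWord w ++ X ≈ X
  invWord-inverseʳ []      X = ≈refl
  invWord-inverseʳ (a ∷ w) X = begin
    a ∷ w ++ invWord (a ∷ w) ++ X              ≡⟨ cong (λ v → a ∷ w ++ v ++ X) (invWord-∷ a w) ⟩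
    a ∷ w ++ (invWord w ++ invLetter a ∷ []) ++ X ≡⟨ cong (λ v → a ∷ w ++ v) (++-assoc (invWord w) _ X) ⟩
    a ∷ w ++ invWord w ++ invLetter a ∷ X      ∼⟨ ≈-congˡ (a ∷ []) (invWord-inverseʳ w _) ⟩
    a ∷ invLetter a ∷ X                        ∼⟨ cancel-∷ a X ⟩
    X                                          ∎

  invWord-inverseˡ : ∀ w X → invWord w ++ w ++ X ≈ X
  invWord-inverseˡ []      X = ≈refl
  invWord-inverseˡ (a ∷ w) X = begin
    invWord (a ∷ w) ++ a ∷ w ++ X              ≡⟨ cong (_++ a ∷ w ++ X) (invWord-∷ a w) ⟩
    (invWord w ++ invLetter a ∷ []) ++ a ∷ w ++ X ≡⟨ ++-assoc (invWord w) _ _ ⟩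
    invWord w ++ invLetter a ∷ a ∷ w ++ X      ∼⟨ ≈-congˡ (invWord w) (cancel-inv-∷ a _) ⟩
    invWord w ++ w ++ X                        ∼⟨ invWord-inverseˡ w X ⟩
    X                                          ∎

extend-++ : ∀ {G H : Set} (φ : G → Word H) u v → extend φ (u ++ v) ≡ extend φ u ++ extend φ v
extend-++ φ = concatMap-++ _

extend-cong : ∀ {G H : Set} {R : Word G → Word G → Set} {S : Word H → Word H → Set}
  (φ : G → Word H) → (∀ {u v} → R u v → extend φ u ≈⟨ S ⟩ extend φ v) →
  ∀ {u v} → u ≈⟨ R ⟩ v → extend φ u ≈⟨ S ⟩ extend φ v
extend-cong φ φ-resp (rel r)           = φ-resp r
extend-cong φ φ-resp (cancel (pos g))  = Presentation.invWord-inverseʳ _ (φ g) []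
extend-cong φ φ-resp (cancel (neg g))  = Presentation.invWord-inverseˡ _ (φ g) []
extend-cong φ φ-resp ≈refl             = ≈refl
extend-cong φ φ-resp (≈sym d)          = ≈sym (extend-cong φ φ-resp d)
extend-cong φ φ-resp (≈trans d e)      = ≈trans (extend-cong φ φ-resp d) (extend-cong φ φ-resp e)
extend-cong φ φ-resp (≈cong {u = u} {v} p q d) =
  subst₂ (_≈⟨ _ ⟩_) (sym (expand u)) (sym (expand v)) (≈cong (extend φ p) (extend φ q) (extend-cong φ φ-resp d))
  where
  expand : ∀ w → extend φ (p ++ w ++ q) ≡ extend φ p ++ extend φ w ++ extend φ q
  expand w = trans (extend-++ φ p (w ++ q)) (cong (extend φ p ++_) (extend-++ φ w q))

extend-≗ : ∀ {G H : Set} {φ ψ : G → Word H} → (∀ g → φ g ≡ ψ g) → ∀ w → extend φ w ≡ extend ψ w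
extend-≗ φ≗ψ = concatMap-cong λ where
  (pos g) → φ≗ψ g
  (neg g) → cong invWord (φ≗ψ g)

fold-pull : ∀ {A : Set} (F : A → A) x j → fold (F x) F j ≡ F (fold x F j)
fold-pull F x zero    = refl
fold-pull F x (suc j) = cong F (fold-pull F x j)

fold-≗ : ∀ {A : Set} {F F′ : A → A} → (∀ x → F x ≡ F′ x) → ∀ x j → fold x F j ≡ fold x F′ j
fold-≗ F≗F′ x zero    = refl
fold-≗ {F = F} F≗F′ x (suc j) = trans (cong F (fold-≗ F≗F′ x j)) (F≗F′ _)

tabulate-toℕ : ∀ {A : Set} (f : ℕ → A) m → tabulate {n = m} (λ i → f (toℕ i)) ≡ applyUpTo f m
tabulate-toℕ f zero    = refl
tabulate-toℕ f (suc m) = cong (f 0 ∷_) (tabulate-toℕ (λ i → f (suc i)) m)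

concat-replicate-++ : ∀ {A : Set} (w : List A) k X → concat (replicate k w) ++ X ≡ fold X (w ++_) k
concat-replicate-++ w zero    X = refl
concat-replicate-++ w (suc k) X = trans (++-assoc w _ X) (cong (w ++_) (concat-replicate-++ w k X))

extend-concat-replicate : ∀ {G H : Set} (φ : G → Word H) k w →
  extend φ (concat (replicate k w)) ≡ concat (replicate k (extend φ w))
extend-concat-replicate φ zero    w = refl
extend-concat-replicate φ (suc k) w =
  trans (extend-++ φ w _) (cong (extend φ w ++_) (extend-concat-replicate φ k w))

module BraidA (N : ℕ) where

  open Presentation (RelA N) public

  W : Set
  W = Word (GenA N)

  -- s i is σ̃_{i+1}, and the empty word when i + 1 ≥ N, so that s is total on ℕ.
  s : ℕ → W
  s i with i <? N ∸ 1
  ... | yes i<N-1 = pos (fromℕ< i<N-1) ∷ []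
  ... | no  _     = []

  s-fromℕ< : ∀ {i} (i<N-1 : i < N ∸ 1) → s i ≡ pos (fromℕ< i<N-1) ∷ []
  s-fromℕ< {i} i<N-1 with i <? N ∸ 1
  ... | yes _   = refl
  ... | no  i≮ = ⊥-elim (i≮ i<N-1)

  s-toℕ : (i : GenA N) → s (toℕ i) ≡ pos i ∷ []
  s-toℕ i = trans (s-fromℕ< (toℕ<n i)) (cong (λ j → pos j ∷ []) (fromℕ<-toℕ i _))

  s-comm : ∀ i j X → suc i < j → s i ++ s j ++ X ≈ s j ++ s i ++ X
  s-comm i j X i+1<j with i <? N ∸ 1 | j <? N ∸ 1
  ... | yes p | yes q = ≈-congʳ X (rel (commA (fromℕ< p) (fromℕ< q)
                          (subst₂ (λ a b → suc a < b) (sym (toℕ-fromℕ< p)) (sym (toℕ-fromℕ< q)) i+1<j)))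
  ... | yes _ | no  _ = ≈refl
  ... | no  _ | _     = ≈refl

  s-braid : ∀ i X → suc i < N ∸ 1 → s i ++ s (suc i) ++ s i ++ X ≈ s (suc i) ++ s i ++ s (suc i) ++ X
  s-braid i X i+1<N-1 rewrite s-fromℕ< (<-trans (n<1+n i) i+1<N-1) | s-fromℕ< i+1<N-1 =
    ≈-congʳ X (rel (braidA _ _ (trans (toℕ-fromℕ< i+1<N-1) (cong suc (sym (toℕ-fromℕ< _))))))

  -- Words are written in continuation-passing form: down m X is σ̃_m ⋯ σ̃_1 X.
  down : ℕ → W → W
  down zero    X = X
  down (suc m) X = s m ++ down m X

  up : ℕ → ℕ → W → W
  up b zero    X = X
  up b (suc j) X = s b ++ up (suc b) j X

  loop : ℕ → W → W
  loop zero    X = X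
  loop (suc m) X = s m ++ loop m (s m ++ X)

  twist : ℕ → W → W
  twist k X = fold X (down (k ∸ 1)) k

  down-cong : ∀ m {X Y} → X ≈ Y → down m X ≈ down m Y
  down-cong zero    X≈Y = X≈Y
  down-cong (suc m) X≈Y = ≈-congˡ (s m) (down-cong m X≈Y)

  loop-cong : ∀ m {X Y} → X ≈ Y → loop m X ≈ loop m Y
  loop-cong zero    X≈Y = X≈Y
  loop-cong (suc m) X≈Y = ≈-congˡ (s m) (loop-cong m (≈-congˡ (s m) X≈Y))

  fold-down-cong : ∀ m j {X Y} → X ≈ Y → fold X (down m) j ≈ fold Y (down m) j
  fold-down-cong m zero    X≈Y = X≈Y
  fold-down-cong m (suc j) X≈Y = down-cong m (fold-down-cong m j X≈Y)

  down-comm : ∀ m j X → m < j → s j ++ down m X ≈ down m (s j ++ X)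
  down-comm zero    j X m<j = ≈refl
  down-comm (suc m) j X m<j = begin
    s j ++ s m ++ down m X   ∼⟨ ≈sym (s-comm m j _ m<j) ⟩
    s m ++ s j ++ down m X   ∼⟨ ≈-congˡ (s m) (down-comm m j X (<-trans (n<1+n m) m<j)) ⟩
    s m ++ down m (s j ++ X) ∎

  down-conj : ∀ i k X → i < k → k < N ∸ 1 → down (suc k) (s (suc i) ++ X) ≈ s i ++ down (suc k) X
  down-conj i (suc k) X i<k+1 k+1<N-1 with m≤n⇒m<n∨m≡n (s≤s⁻¹ i<k+1)
  ... | inj₂ refl = begin
    s (suc i) ++ s i ++ down i (s (suc i) ++ X) ∼⟨ ≈-congˡ (s (suc i)) (≈-congˡ (s i) (≈sym (down-comm i (suc i) X (n<1+n i)))) ⟩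
    s (suc i) ++ s i ++ s (suc i) ++ down i X   ∼⟨ ≈sym (s-braid i _ k+1<N-1) ⟩
    s i ++ s (suc i) ++ s i ++ down i X         ∎
  ... | inj₁ i<k = begin
    s (suc k) ++ down (suc k) (s (suc i) ++ X) ∼⟨ ≈-congˡ (s (suc k)) (down-conj i k X i<k (<-trans (n<1+n k) k+1<N-1)) ⟩
    s (suc k) ++ s i ++ down (suc k) X         ∼⟨ ≈sym (s-comm i (suc k) _ (s≤s i<k)) ⟩
    s i ++ s (suc k) ++ down (suc k) X         ∎

  down-down : ∀ m X → m < N ∸ 1 → down (suc m) (down (suc m) X) ≈ down m (down (suc m) (s 0 ++ X))
  down-down zero    X _ = ≈refl
  down-down (suc m) X m+1<N-1 = begin
    x ++ y ++ down m (x ++ y ++ down m X)        ∼⟨ ≈-congˡ x (≈-congˡ y (≈sym (down-comm m (suc m) _ (n<1+n m)))) ⟩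
    x ++ y ++ x ++ down m (y ++ down m X)        ∼⟨ ≈sym (s-braid m _ m+1<N-1) ⟩
    y ++ x ++ y ++ down m (y ++ down m X)        ∼⟨ ≈-congˡ y (≈-congˡ x (down-down m X (<-trans (n<1+n m) m+1<N-1))) ⟩
    y ++ x ++ down m (y ++ down m (s 0 ++ X))    ∼⟨ ≈-congˡ y (down-comm m (suc m) _ (n<1+n m)) ⟩
    y ++ down m (x ++ y ++ down m (s 0 ++ X))    ∎
    where x = s (suc m); y = s m

  up-down : ∀ b j k X → b + j ≤ k → k < N ∸ 1 → up b j (down (suc k) X) ≈ down (suc k) (up (suc b) j X)
  up-down b zero    k X _ _ = ≈refl
  up-down b (suc j) k X b+j+1≤k k<N-1 = begin
    s b ++ up (suc b) j (down (suc k) X)        ∼⟨ ≈-congˡ (s b) (up-down (suc b) j k X b+1+j≤k k<N-1) ⟩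
    s b ++ down (suc k) (up (suc (suc b)) j X)  ∼⟨ ≈sym (down-conj b k _ (≤-trans (s≤s (m≤m+n b j)) b+1+j≤k) k<N-1) ⟩
    down (suc k) (up (suc b) (suc j) X)         ∎
    where b+1+j≤k = subst (_≤ k) (+-suc b j) b+j+1≤k

  fold-down-suc : ∀ k j X → j ≤ suc k → k < N ∸ 1 →
    fold X (down (suc k)) (suc j) ≈ fold (down (suc k) (up 0 j X)) (down k) j
  fold-down-suc k zero    X _ _ = ≈refl
  fold-down-suc k (suc j) X (s≤s j≤k) k<N-1 = begin
    fold X (down (suc k)) (suc (suc j))
      ≡⟨ fold-pull (down (suc k)) X (suc j) ⟨
    fold (down (suc k) X) (down (suc k)) (suc j)
      ∼⟨ fold-down-suc k j _ (m≤n⇒m≤1+n j≤k) k<N-1 ⟩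
    fold (down (suc k) (up 0 j (down (suc k) X))) (down k) j
      ∼⟨ fold-down-cong k j (down-cong (suc k) (up-down 0 j k X j≤k k<N-1)) ⟩
    fold (down (suc k) (down (suc k) (up 1 j X))) (down k) j
      ∼⟨ fold-down-cong k j (down-down k _ k<N-1) ⟩
    fold (down k (down (suc k) (up 0 (suc j) X))) (down k) j
      ≡⟨ fold-pull (down k) _ j ⟩
    fold (down (suc k) (up 0 (suc j) X)) (down k) (suc j) ∎

  up-snoc : ∀ b j X → up b (suc j) X ≡ up b j (s (b + j) ++ X)
  up-snoc b zero    X = cong (λ c → s c ++ X) (sym (+-identityʳ b))
  up-snoc b (suc j) X =
    cong (s b ++_) (trans (up-snoc (suc b) j X) (cong (λ c → up (suc b) j (s c ++ X)) (sym (+-suc b j))))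

  loop≡down-up : ∀ m X → loop m X ≡ down m (up 0 m X)
  loop≡down-up zero    X = refl
  loop≡down-up (suc m) X =
    cong (s m ++_) (trans (loop≡down-up m (s m ++ X)) (cong (down m) (sym (up-snoc 0 m X))))

  twist-suc : ∀ m X → m ≤ N ∸ 1 → twist (suc m) X ≈ twist m (loop m X)
  twist-suc zero    X _ = ≈refl
  twist-suc (suc k) X k<N-1 = begin
    fold X (down (suc k)) (suc (suc k))                     ∼⟨ fold-down-suc k (suc k) X ≤-refl k<N-1 ⟩
    fold (down (suc k) (up 0 (suc k) X)) (down k) (suc k)   ≡⟨ cong (λ Y → fold Y (down k) (suc k)) (loop≡down-up (suc k) X) ⟨
    fold (loop (suc k) X) (down k) (suc k)                  ∎

  loop-comm : ∀ m j X → m < j → s j ++ loop m X ≈ loop m (s j ++ X)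
  loop-comm zero    j X _ = ≈refl
  loop-comm (suc m) j X m<j = begin
    s j ++ s m ++ loop m (s m ++ X)  ∼⟨ ≈sym (s-comm m j _ m<j) ⟩
    s m ++ s j ++ loop m (s m ++ X)  ∼⟨ ≈-congˡ (s m) (loop-comm m j _ (<-trans (n<1+n m) m<j)) ⟩
    s m ++ loop m (s j ++ s m ++ X)  ∼⟨ ≈-congˡ (s m) (loop-cong m (≈sym (s-comm m j X m<j))) ⟩
    s m ++ loop m (s m ++ s j ++ X)  ∎

  loop-braid : ∀ m X → m < N ∸ 1 → s m ++ loop m (s m ++ loop m X) ≈ loop m (s m ++ loop m (s m ++ X))
  loop-braid zero    X _ = ≈refl
  loop-braid (suc m) X m+1<N-1 = begin
    x ++ y ++ L (y ++ x ++ y ++ L (y ++ X))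
      ∼⟨ ≈-congˡ x (≈-congˡ y (loop-cong m (s-braid m _ m+1<N-1))) ⟩
    x ++ y ++ L (x ++ y ++ x ++ L (y ++ X))
      ∼⟨ ≈-congˡ x (≈-congˡ y (≈sym (loop-comm m (suc m) _ (n<1+n m)))) ⟩
    x ++ y ++ x ++ L (y ++ x ++ L (y ++ X))
      ∼⟨ ≈-congˡ x (≈-congˡ y (≈-congˡ x (loop-cong m (≈-congˡ y (loop-comm m (suc m) _ (n<1+n m)))))) ⟩
    x ++ y ++ x ++ L (y ++ L (x ++ y ++ X))
      ∼⟨ ≈sym (s-braid m _ m+1<N-1) ⟩
    y ++ x ++ y ++ L (y ++ L (x ++ y ++ X))
      ∼⟨ ≈-congˡ y (≈-congˡ x (loop-braid m (x ++ y ++ X) (<-trans (n<1+n m) m+1<N-1))) ⟩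
    y ++ x ++ L (y ++ L (y ++ x ++ y ++ X))
      ∼⟨ ≈-congˡ y (≈-congˡ x (loop-cong m (≈-congˡ y (loop-cong m (s-braid m X m+1<N-1))))) ⟩
    y ++ x ++ L (y ++ L (x ++ y ++ x ++ X))
      ∼⟨ ≈-congˡ y (≈-congˡ x (loop-cong m (≈-congˡ y (≈sym (loop-comm m (suc m) _ (n<1+n m)))))) ⟩
    y ++ x ++ L (y ++ x ++ L (y ++ x ++ X))
      ∼⟨ ≈-congˡ y (loop-comm m (suc m) _ (n<1+n m)) ⟩
    y ++ L (x ++ y ++ x ++ L (y ++ x ++ X))
      ∼⟨ ≈-congˡ y (loop-cong m (≈sym (s-braid m _ m+1<N-1))) ⟩
    y ++ L (y ++ x ++ y ++ L (y ++ x ++ X)) ∎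
    where x = s (suc m); y = s m; L = loop m

module _ (N : ℕ) where

  open BraidA N using (W; s; s-toℕ; down; twist)
  open ≡-Reasoning

  concat-applyDownFrom-++ : ∀ m X → concat (applyDownFrom s m) ++ X ≡ down m X
  concat-applyDownFrom-++ zero    X = refl
  concat-applyDownFrom-++ (suc m) X = trans (++-assoc (s m) _ X) (cong (s m ++_) (concat-applyDownFrom-++ m X))

  extend-descending : ∀ {m} (φ : Fin m → W) → (∀ i → φ i ≡ s (toℕ i)) →
    extend φ (map pos (reverse (allFin m))) ≡ concat (applyDownFrom s m)
  extend-descending {m} φ φ≗s = begin
    extend φ (map pos (reverse (allFin m)))        ≡⟨ concatMap-map _ pos (reverse (allFin m)) ⟩
    concatMap φ (reverse (allFin m))               ≡⟨ concatMap-cong φ≗s (reverse (allFin m)) ⟩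
    concat (map (λ i → s (toℕ i)) (reverse (allFin m))) ≡⟨ cong concat (reverse-map _ (allFin m)) ⟩
    concat (reverse (map (λ i → s (toℕ i)) (allFin m))) ≡⟨ cong (concat ∘ reverse) (map-tabulate {n = m} (λ i → i) (λ i → s (toℕ i))) ⟩
    concat (reverse (tabulate {n = m} (λ i → s (toℕ i)))) ≡⟨ cong (concat ∘ reverse) (tabulate-toℕ s m) ⟩
    concat (reverse (applyUpTo s m))               ≡⟨ cong concat (reverse-applyUpTo s m) ⟩
    concat (applyDownFrom s m)                     ∎

  twist-inclA : ∀ {k} (k≤N : k ≤ N) X → inclA k≤N (fullTwist k) ++ X ≡ twist k X
  twist-inclA {k} k≤N X = begin
    extend φ (concat (replicate k δ)) ++ X   ≡⟨ cong (_++ X) (extend-concat-replicate φ k δ) ⟩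
    concat (replicate k (extend φ δ)) ++ X   ≡⟨ concat-replicate-++ (extend φ δ) k X ⟩
    fold X (extend φ δ ++_) k                ≡⟨ fold-≗ δ-down X k ⟩
    twist k X                                ∎
    where
    k-1≤N-1 = ∸-monoˡ-≤ 1 k≤N
    φ : GenA k → W
    φ i = pos (inject≤ i k-1≤N-1) ∷ []
    δ = map pos (reverse (allFin (k ∸ 1)))
    φ≗s : ∀ i → φ i ≡ s (toℕ i)
    φ≗s i = trans (sym (s-toℕ (inject≤ i k-1≤N-1))) (cong s (toℕ-inject≤ i k-1≤N-1))
    δ-down : ∀ Y → extend φ δ ++ Y ≡ down (k ∸ 1) Y
    δ-down Y = trans (cong (_++ Y) (extend-descending φ φ≗s)) (concat-applyDownFrom-++ (k ∸ 1) Y)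

module _ (N : ℕ) where

  open BraidA N

  twist-quotient : ∀ {k} (k≤N : k ≤ N) (k+1≤N : suc k ≤ N) X →
    (invWord (inclA k≤N (fullTwist k)) ++ inclA k+1≤N (fullTwist (suc k))) ++ X ≈ loop k X
  twist-quotient {k} k≤N k+1≤N X = begin
    (invWord Δ ++ Δ′) ++ X           ≡⟨ ++-assoc (invWord Δ) Δ′ X ⟩
    invWord Δ ++ Δ′ ++ X             ≡⟨ cong (invWord Δ ++_) (twist-inclA N k+1≤N X) ⟩
    invWord Δ ++ twist (suc k) X     ∼⟨ ≈-congˡ (invWord Δ) (twist-suc k X (∸-monoˡ-≤ 1 k+1≤N)) ⟩
    invWord Δ ++ twist k (loop k X)  ≡⟨ cong (invWord Δ ++_) (twist-inclA N k≤N _) ⟨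
    invWord Δ ++ Δ ++ loop k X       ∼⟨ invWord-inverseˡ Δ _ ⟩
    loop k X                         ∎
    where
    Δ = inclA k≤N (fullTwist k)
    Δ′ = inclA k+1≤N (fullTwist (suc k))

module _ (f n : ℕ) (1≤n : 1 ≤ n) where

  open BraidA (f + n)

  private
    T : W
    T = ρgen f n 1≤n t

  σ-bound : (i : Fin (n ∸ 1)) → f + toℕ i < f + n ∸ 1
  σ-bound i = subst (f + toℕ i <_) (sym (+-∸-assoc f 1≤n)) (+-monoʳ-< f (toℕ<n i))

  ρ′gen : GenB n → W
  ρ′gen t     = T
  ρ′gen (σ i) = s (f + toℕ i)

  ρgen≗ρ′gen : ∀ g → ρgen f n 1≤n g ≡ ρ′gen g
  ρgen≗ρ′gen t     = refl
  ρgen≗ρ′gen (σ i) = sym (s-fromℕ< (σ-bound i))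

  ρ-t : ∀ X → T ++ X ≈ loop f X
  ρ-t = twist-quotient (f + n) (m≤m+n f n) (subst (_≤ f + n) (+-comm f 1) (+-monoʳ-≤ f 1≤n))

  ρ-t-twice : ∀ x X → T ++ x ++ T ++ X ≈ loop f (x ++ loop f X)
  ρ-t-twice x X = ≈trans (ρ-t _) (loop-cong f (≈-congˡ x (ρ-t X)))

  ρ′-resp : ∀ {u v} → RelB n u v → extend ρ′gen u ≈ extend ρ′gen v
  ρ′-resp (commB i j i+1<j) =
    s-comm _ _ [] (subst (_< f + toℕ j) (+-suc f (toℕ i)) (+-monoʳ-< f i+1<j))
  ρ′-resp (braidB i j j≡i+1) rewrite j≡i+1 | +-suc f (toℕ i) =
    s-braid _ [] (subst (_< f + n ∸ 1) (trans (cong (f +_) j≡i+1) (+-suc f (toℕ i))) (σ-bound j))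
  ρ′-resp (tσ₁ i i≡0) rewrite i≡0 | +-identityʳ f = begin
    s f ++ T ++ s f ++ T ++ []          ∼⟨ ≈-congˡ (s f) (ρ-t-twice (s f) []) ⟩
    s f ++ loop f (s f ++ loop f [])    ∼⟨ loop-braid f [] f<N-1 ⟩
    loop f (s f ++ loop f (s f ++ []))  ∼⟨ ≈sym (ρ-t-twice (s f) _) ⟩
    T ++ s f ++ T ++ s f ++ []          ∎
    where f<N-1 = subst (_< f + n ∸ 1) (trans (cong (f +_) i≡0) (+-identityʳ f)) (σ-bound i)
  ρ′-resp (tσᵢ i 1≤i) = begin
    T ++ s j ++ []         ∼⟨ ρ-t _ ⟩
    loop f (s j ++ [])     ∼⟨ ≈sym (loop-comm f j [] (m<m+n f 1≤i)) ⟩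
    s j ++ loop f []       ∼⟨ ≈-congˡ (s j) (≈sym (ρ-t [])) ⟩
    s j ++ T ++ []         ∎
    where j = f + toℕ i

  ρ-resp : ∀ {u v} → RelB n u v → ρ f n 1≤n u ≈ ρ f n 1≤n v
  ρ-resp {u} {v} r = subst₂ _≈_ (sym (extend-≗ ρgen≗ρ′gen u)) (sym (extend-≗ ρgen≗ρ′gen v)) (ρ′-resp r)

proposition1p1 : (f n : ℕ) → 1 ≤ f → (1≤n : 1 ≤ n) →
    ∀ {u v : Word (GenB n)} → u ≈⟨ RelB n ⟩ v →
    ρ f n 1≤n u ≈⟨ RelA (f + n) ⟩ ρ f n 1≤n v
proposition1p1 f n _ 1≤n = extend-cong (ρgen f n 1≤n) (ρ-resp f n 1≤n)
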